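{- Let $\underline{\alpha},\underline{\beta}\in\mathbb{Z}^+_m$ and $A,B\in\mathbb{N}_m$ with $\underline{\alpha}A=\underline{\beta}B$. If $\underline{\alpha}_1,\underline{\alpha}_2,\underline{\beta}_1,\underline{\beta}_2\in\mathbb{Z}^+_m$ satisfy $\underline{\alpha}_1\underline{\alpha}_2=\underline{\beta}_1\underline{\beta}_2$, then $(\underline{\alpha}\,\underline{\alpha}_2)(\underline{\alpha}_1A)=(\underline{\beta}\,\underline{\beta}_2)(\underline{\beta}_1B)$, i.e. $R_{\underline{\alpha}_1A,\underline{\alpha}\,\underline{\alpha}_2}=R_{\underline{\beta}_1B,\underline{\beta}\,\underline{\beta}_2}$.
   Context: A multiset $M$ of nonnegative integers is described by its multiplicity function $\chi_M$. $\mathbb{N}_m$ is the family of multisets $M$ of nonnegative integers with $\chi_M(0)=1$ and $\chi_M(n)<\infty$ for $n\ge1$. $\mathbb{Z}^+_m$ is the set of finite vectors $(\alpha_1,\dots,\alpha_s)$ ($s\ge1$ arbitrary) of positive integers with $\alpha_1\le\cdots\le\alpha_s$. For a multiset $A$ and positive integer $k$, $kA=\{ka:a\in A\}$ with multiplicities; sums of multisets count all pairs with multiplicity; $\underline{\alpha}A=\alpha_1A+\cdots+\alpha_sA$, so the multiplicity of $n$ in $\underline{\alpha}A$ is $R_{A,\underline{\alpha}}(n)=|\{(j_1,\dots,j_s)\in(\mathbb{Z}^+)^s:\sum_i\alpha_ia_{j_i}=n\}|$ where $A=\{a_1\le a_2\le\cdots\}$ is listed with multiplicity. For $\underline{\alpha}=(\alpha_1,\dots,\alpha_s)$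 and $\underline{\beta}=(\beta_1,\dots,\beta_t)$, the (ordered Kronecker) product $\underline{\alpha}\,\underline{\beta}\in\mathbb{Z}^+_m$ is the vector of length $st$ consisting of all products $\alpha_i\beta_j$ ($1\le i\le s$, $1\le j\le t$), arranged in nondecreasing order. -}

module Defs where

open import Data.Nat using (ℕ; zero; suc; _+_; _*_; _∸_; _<_; _≟_)
open import Data.Nat.Properties using (≤-decTotalOrder; ≤-totalOrder)
open import Data.List using (List; []; _∷_; map; concatMap; upTo)
open import Data.Nat.ListAction using (sum)
open import Data.List.Relation.Unary.All using (All)
open import Data.List.Relation.Unary.Sorted.TotalOrder ≤-totalOrder using (Sorted)
open import Relation.Binary.PropositionalEquality using (_≡_; _≢_)
open import Relation.Nullary using (yes; no)
open import Data.Product using (_×_)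

-- Multisets in ℕ_m: multiplicity function χ with χ 0 = 1
-- (finiteness of every multiplicity is automatic since χ n : ℕ).
record NMultiset : Set where
  field
    χ  : ℕ → ℕ
    χ0 : χ 0 ≡ 1
open NMultiset public

IsZm : List ℕ → Set
IsZm l = (l ≢ []) × All (0 <_) l × Sorted l

open import Data.List.Sort ≤-decTotalOrder using (sort)

kron : List ℕ → List ℕ → List ℕ
kron α β = sort (concatMap (λ a → map (a *_) β) α)

-- Multiplicity function of the dilation kA = {k a : a ∈ A}:
-- number of elements a of A (with multiplicity) with k*a = n.
-- For k ≥ 1 any such a satisfies a ≤ n.
dil : ℕ → (ℕ → ℕ) → ℕ → ℕ
dil k f n = sum (map (λ m → indic (k * m) m) (upTo (suc n)))
  where
  indic : ℕ → ℕ → ℕ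
  indic x m with x ≟ n
  ... | yes _ = f m
  ... | no  _ = 0

-- Multiplicity function of the multiset sum A + B (all pairs counted).
conv : (ℕ → ℕ) → (ℕ → ℕ) → ℕ → ℕ
conv f g n = sum (map (λ i → f i * g (n ∸ i)) (upTo (suc n)))

-- Multiplicity function R_{A,α} of αA = α₁A + ⋯ + αₛA  (s ≥ 1).
-- (The empty list never occurs for α ∈ ℤ⁺_m; it is given the value 0.)
R : (ℕ → ℕ) → List ℕ → ℕ → ℕ
R f []           n = 0
R f (a ∷ [])     n = dil a f n
R f (a ∷ b ∷ as) n = conv (dil a f) (R f (b ∷ as)) n

-- Multiplicity functions form a commutative monoid under convolution (the multiset sum), and for
-- k > 0 the dilation A ↦ kA is a monoid endomorphism with k(lA) = (kl)A.  Hence R_{A,α} is the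
-- convolution product of the dilates aA (a ∈ α), and β(αA) = (βα)A.  Both (α α₂)(α₁A) and
-- (α₁ α₂)(αA) are thus the product of the dilates (a x y)A over a ∈ α, x ∈ α₂, y ∈ α₁, so the
-- former depends on A only through αA and on α₁, α₂ only through α₁ α₂.
-- The monoid laws are proved by writing convolution and dilation as sums over a box weighted by
-- a Kronecker delta, exchanging the order of summation and collapsing the deltas.
module Submission where

open import Defs
open import Algebra.Bundles using (CommutativeMonoid)
open import Algebra.Structures using (IsCommutativeMonoid)
open import Data.Empty using (⊥-elim)
open import Data.List using (List; []; _∷_; _++_; map; foldr; concatMap; applyUpTo; upTo)
open import Data.List.Properties using (map-cong; map-∘)
open import Data.List.Relation.Unary.All as All using (All; []; _∷_)
open import Data.List.Relation.Unary.All.Properties as All using (concat⁺)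
open import Data.List.Relation.Binary.Permutation.Propositional using (_↭_; ↭-sym; ↭⇒↭ₛ′)
open import Data.List.Relation.Binary.Permutation.Propositional.Properties using (map⁺; All-resp-↭; ¬x∷xs↭[])
open import Data.Nat using (ℕ; zero; suc; _+_; _*_; _∸_; _<_; _≤_; _≟_; z≤n; >-nonZero)
open import Data.Nat.ListAction using (sum)
open import Data.Nat.Properties
open import Data.Nat.Tactic.RingSolver using (solve-∀)
open import Data.List.Sort ≤-decTotalOrder using (sort-↭)
open import Algebra.Properties.CommutativeSemigroup +-commutativeSemigroup using () renaming (interchange to +-interchange)
open import Algebra.Properties.CommutativeSemigroup *-commutativeSemigroup using (x∙yz≈y∙xz; xy∙z≈xz∙y; xy∙z≈zy∙x)
open import Data.Product using (_×_; _,_; proj₁; proj₂)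
open import Function.Base using (_∘_; id)
open import Level using (0ℓ)
open import Relation.Binary.Bundles using (Setoid)
open import Relation.Binary.Definitions using (tri<; tri≈; tri>)
open import Relation.Binary.PropositionalEquality
  using (_≡_; _≢_; _≗_; refl; sym; trans; cong; cong₂; subst; module ≡-Reasoning; _→-setoid_)
import Relation.Binary.Reasoning.Setoid as ≈-Reasoning
open import Relation.Nullary using (yes; no)

module BigProduct {c ℓ} (M : CommutativeMonoid c ℓ) where

  open CommutativeMonoid M
    renaming (refl to ≈-refl; sym to ≈-sym; trans to ≈-trans; reflexive to ≈-reflexive)
  open import Algebra.Properties.CommutativeSemigroup commutativeSemigroup using (interchange)
  open ≈-Reasoning setoid
  open import Data.List.Relation.Binary.Permutation.Setoid.Properties setoid using (foldr-commMonoid)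

  ∏ : {I : Set} → List I → (I → Carrier) → Carrier
  ∏ L F = foldr _∙_ ε (map F L)

  module _ {I : Set} where

    ∏-cong-All : ∀ {P : I → Set} {L F G} → All P L → (∀ {i} → P i → F i ≈ G i) → ∏ L F ≈ ∏ L G
    ∏-cong-All []         F≈G = ≈-refl
    ∏-cong-All (px ∷ pxs) F≈G = ∙-cong (F≈G px) (∏-cong-All pxs F≈G)

    ∏-cong : ∀ (L : List I) {F G} → (∀ i → F i ≈ G i) → ∏ L F ≈ ∏ L G
    ∏-cong []      F≈G = ≈-refl
    ∏-cong (i ∷ L) F≈G = ∙-cong (F≈G i) (∏-cong L F≈G)

    ∏-↭ : ∀ {L L′ : List I} F → L ↭ L′ → ∏ L F ≈ ∏ L′ F
    ∏-↭ F L↭L′ = foldr-commMonoid isCommutativeMonoid (↭⇒↭ₛ′ isEquivalence (map⁺ F L↭L′))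

    ∏-++ : ∀ (L L′ : List I) F → ∏ (L ++ L′) F ≈ ∏ L F ∙ ∏ L′ F
    ∏-++ []      L′ F = ≈-sym (identityˡ _)
    ∏-++ (i ∷ L) L′ F = ≈-trans (∙-congˡ (∏-++ L L′ F)) (≈-sym (assoc _ _ _))

    ∏-ε : ∀ (L : List I) → ∏ L (λ _ → ε) ≈ ε
    ∏-ε []      = ≈-refl
    ∏-ε (i ∷ L) = ≈-trans (identityˡ _) (∏-ε L)

    ∏-distrib : ∀ (L : List I) F G → ∏ L (λ i → F i ∙ G i) ≈ ∏ L F ∙ ∏ L G
    ∏-distrib []      F G = ≈-sym (identityˡ ε)
    ∏-distrib (i ∷ L) F G = ≈-trans (∙-congˡ (∏-distrib L F G)) (interchange _ _ _ _)

    ∏-comm : ∀ (L : List I) {J : Set} (L′ : List J) (F : I → J → Carrier) →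
             ∏ L (λ i → ∏ L′ (F i)) ≈ ∏ L′ (λ j → ∏ L (λ i → F i j))
    ∏-comm L []       F = ∏-ε L
    ∏-comm L (j ∷ L′) F =
      ≈-trans (∏-distrib L (λ i → F i j) (λ i → ∏ L′ (F i))) (∙-congˡ (∏-comm L L′ F))

    ∏-hom : ∀ (h : Carrier → Carrier) → h ε ≈ ε → (∀ x y → h (x ∙ y) ≈ h x ∙ h y) →
            ∀ (L : List I) F → h (∏ L F) ≈ ∏ L (h ∘ F)
    ∏-hom h h-ε h-∙ []      F = h-ε
    ∏-hom h h-ε h-∙ (i ∷ L) F = ≈-trans (h-∙ _ _) (∙-congˡ (∏-hom h h-ε h-∙ L F))

    ∏-map : ∀ {J : Set} (g : J → I) L F → ∏ (map g L) F ≈ ∏ L (F ∘ g)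
    ∏-map g L F = ≈-reflexive (cong (foldr _∙_ ε) (sym (map-∘ L)))

    ∏-concatMap : ∀ {J : Set} (g : J → List I) L F → ∏ (concatMap g L) F ≈ ∏ L (λ j → ∏ (g j) F)
    ∏-concatMap g []      F = ≈-refl
    ∏-concatMap g (j ∷ L) F = ≈-trans (∏-++ (g j) (concatMap g L) F) (∙-congˡ (∏-concatMap g L F))

  ∏-kron : ∀ P Q G → ∏ (kron P Q) G ≈ ∏ P (λ p → ∏ Q (λ q → G (p * q)))
  ∏-kron P Q G = begin
    ∏ (kron P Q) G                                    ≈⟨ ∏-↭ G (sort-↭ _) ⟩
    ∏ (concatMap (λ p → map (p *_) Q) P) G            ≈⟨ ∏-concatMap _ P G ⟩
    ∏ P (λ p → ∏ (map (p *_) Q) G)                    ≈⟨ ∏-cong P (λ p → ∏-map (p *_) Q G) ⟩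
    ∏ P (λ p → ∏ Q (λ q → G (p * q)))                 ∎

  ∏-reverse₃ : ∀ {I J K : Set} (L₁ : List I) (L₂ : List J) (L₃ : List K)
               (F : I → J → K → Carrier) →
    ∏ L₁ (λ i → ∏ L₂ (λ j → ∏ L₃ (F i j))) ≈ ∏ L₃ (λ k → ∏ L₂ (λ j → ∏ L₁ (λ i → F i j k)))
  ∏-reverse₃ L₁ L₂ L₃ F = begin
    ∏ L₁ (λ i → ∏ L₂ (λ j → ∏ L₃ (F i j)))
      ≈⟨ ∏-cong L₁ (λ i → ∏-comm L₂ L₃ (F i)) ⟩
    ∏ L₁ (λ i → ∏ L₃ (λ k → ∏ L₂ (λ j → F i j k)))
      ≈⟨ ∏-comm L₁ L₃ (λ i k → ∏ L₂ (λ j → F i j k)) ⟩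
    ∏ L₃ (λ k → ∏ L₁ (λ i → ∏ L₂ (λ j → F i j k)))
      ≈⟨ ∏-cong L₃ (λ k → ∏-comm L₁ L₂ (λ i j → F i j k)) ⟩
    ∏ L₃ (λ k → ∏ L₂ (λ j → ∏ L₁ (λ i → F i j k))) ∎

  ∏-kron-kron : ∀ P Q S G →
    ∏ (kron (kron P Q) S) G ≈ ∏ P (λ p → ∏ Q (λ q → ∏ S (λ s → G (p * q * s))))
  ∏-kron-kron P Q S G =
    ≈-trans (∏-kron (kron P Q) S G) (∏-kron P Q (λ pq → ∏ S (λ s → G (pq * s))))

δ : ℕ → ℕ → ℕ
δ x y with x ≟ y
... | yes _ = 1
... | no  _ = 0

δ-refl : ∀ x → δ x x ≡ 1
δ-refl x with x ≟ x
... | yes _ = refl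
... | no x≢x = ⊥-elim (x≢x refl)

δ-≢ : ∀ {x y} → x ≢ y → δ x y ≡ 0
δ-≢ {x} {y} x≢y with x ≟ y
... | yes x≡y = ⊥-elim (x≢y x≡y)
... | no  _   = refl

δ-sym : ∀ x y → δ x y ≡ δ y x
δ-sym x y with x ≟ y
... | yes refl = sym (δ-refl x)
... | no  x≢y  = sym (δ-≢ (x≢y ∘ sym))

δ-> : ∀ {x y} → y < x → δ x y ≡ 0
δ-> y<x = δ-≢ (λ x≡y → <⇒≢ y<x (sym x≡y))

δ-+-vanishˡ : ∀ {n a} b → n < a → δ (a + b) n ≡ 0
δ-+-vanishˡ {a = a} b n<a = δ-> (<-≤-trans n<a (m≤m+n a b))

δ-+-vanishʳ : ∀ {n b} a → n < b → δ (a + b) n ≡ 0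
δ-+-vanishʳ {b = b} a n<b = δ-> (<-≤-trans n<b (m≤n+m b a))

δ-cong-⇔ : ∀ {x y u v} → (x ≡ y → u ≡ v) → (u ≡ v → x ≡ y) → δ x y ≡ δ u v
δ-cong-⇔ {x} {y} {u} {v} to from with x ≟ y
... | yes x≡y = sym (trans (cong (λ z → δ z v) (to x≡y)) (δ-refl v))
... | no  x≢y = sym (δ-≢ (x≢y ∘ from))

∑< : ℕ → (ℕ → ℕ) → ℕ
∑< zero    h = 0
∑< (suc n) h = ∑< n h + h n

syntax ∑< n (λ i → e) = ∑[ i < n ] e

∑-cong-< : ∀ n {h g : ℕ → ℕ} → (∀ i → i < n → h i ≡ g i) → ∑< n h ≡ ∑< n g
∑-cong-< zero    eq = refl
∑-cong-< (suc n) eq = cong₂ _+_ (∑-cong-< n (λ i i<n → eq i (m<n⇒m<1+n i<n))) (eq n ≤-refl)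

∑-cong : ∀ n {h g : ℕ → ℕ} → h ≗ g → ∑< n h ≡ ∑< n g
∑-cong n eq = ∑-cong-< n (λ i _ → eq i)

∑-zero : ∀ n {h : ℕ → ℕ} → (∀ i → i < n → h i ≡ 0) → ∑< n h ≡ 0
∑-zero zero    _  = refl
∑-zero (suc n) eq = cong₂ _+_ (∑-zero n (λ i i<n → eq i (m<n⇒m<1+n i<n))) (eq n ≤-refl)

∑-distrib-+ : ∀ n h g → ∑[ i < n ] (h i + g i) ≡ ∑< n h + ∑< n g
∑-distrib-+ zero    h g = refl
∑-distrib-+ (suc n) h g = trans (cong (_+ (h n + g n)) (∑-distrib-+ n h g))
                                (+-interchange (∑< n h) (∑< n g) (h n) (g n))

∑-distribˡ : ∀ n c h → c * ∑< n h ≡ ∑[ i < n ] (c * h i)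
∑-distribˡ zero    c h = *-zeroʳ c
∑-distribˡ (suc n) c h = trans (*-distribˡ-+ c (∑< n h) (h n)) (cong (_+ c * h n) (∑-distribˡ n c h))

∑-distribʳ : ∀ n c h → ∑< n h * c ≡ ∑[ i < n ] (h i * c)
∑-distribʳ n c h = trans (*-comm (∑< n h) c) (trans (∑-distribˡ n c h) (∑-cong n (λ i → *-comm c (h i))))

∑-comm : ∀ n m (h : ℕ → ℕ → ℕ) → ∑[ i < n ] ∑[ j < m ] h i j ≡ ∑[ j < m ] ∑[ i < n ] h i j
∑-comm zero    m h = sym (∑-zero m (λ _ _ → refl))
∑-comm (suc n) m h = trans (cong (_+ ∑< m (h n)) (∑-comm n m h)) (sym (∑-distrib-+ m _ (h n)))

∑-rotate₃ : ∀ n (h : ℕ → ℕ → ℕ → ℕ) →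
  ∑[ i < n ] ∑[ j < n ] ∑[ k < n ] h i j k ≡ ∑[ j < n ] ∑[ k < n ] ∑[ i < n ] h i j k
∑-rotate₃ n h = trans (∑-comm n n _) (∑-cong n (λ j → ∑-comm n n (λ i k → h i j k)))

∑∑-distribˡ : ∀ n m c (h : ℕ → ℕ → ℕ) →
              c * ∑[ i < n ] ∑[ j < m ] h i j ≡ ∑[ i < n ] ∑[ j < m ] (c * h i j)
∑∑-distribˡ n m c h = trans (∑-distribˡ n c _) (∑-cong n (λ i → ∑-distribˡ m c (h i)))

∑∑-distribʳ : ∀ n m c (h : ℕ → ℕ → ℕ) →
              (∑[ i < n ] ∑[ j < m ] h i j) * c ≡ ∑[ i < n ] ∑[ j < m ] (h i j * c)
∑∑-distribʳ n m c h = trans (∑-distribʳ n c _) (∑-cong n (λ i → ∑-distribʳ m c (h i)))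

∑-split : ∀ n d h → ∑< (n + d) h ≡ ∑< n h + ∑[ i < d ] h (n + i)
∑-split n zero    h = trans (cong (λ m → ∑< m h) (+-identityʳ n)) (sym (+-identityʳ _))
∑-split n (suc d) h = trans (cong (λ m → ∑< m h) (+-suc n d))
  (trans (cong (_+ h (n + d)) (∑-split n d h)) (+-assoc (∑< n h) _ _))

∑-extend : ∀ {n N} h → n ≤ N → (∀ i → n ≤ i → h i ≡ 0) → ∑< N h ≡ ∑< n h
∑-extend {n} {N} h n≤N vanish = begin
  ∑< N h
    ≡⟨ cong (λ m → ∑< m h) (m+[n∸m]≡n n≤N) ⟨
  ∑< (n + (N ∸ n)) h
    ≡⟨ ∑-split n (N ∸ n) h ⟩
  ∑< n h + ∑[ i < N ∸ n ] h (n + i)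
    ≡⟨ cong (∑< n h +_) (∑-zero (N ∸ n) (λ i _ → vanish (n + i) (m≤m+n n i))) ⟩
  ∑< n h + 0
    ≡⟨ +-identityʳ _ ⟩
  ∑< n h ∎
  where open ≡-Reasoning

∑-δ : ∀ N c (h : ℕ → ℕ) → (N ≤ c → h c ≡ 0) → ∑[ k < N ] (δ c k * h k) ≡ h c
∑-δ zero    c h vanish = sym (vanish z≤n)
∑-δ (suc N) c h vanish with <-cmp c N
... | tri< c<N _ _ = trans (cong₂ _+_ (∑-δ N c h (⊥-elim ∘ <⇒≱ c<N)) (cong (_* h N) (δ-≢ (<⇒≢ c<N))))
                           (+-identityʳ (h c))
... | tri≈ _ refl _ = trans (cong₂ _+_ (∑-zero N (λ k k<N → cong (_* h k) (δ-> k<N)))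
                                       (cong (_* h N) (δ-refl N)))
                            (+-identityʳ (h N))
... | tri> _ _ N<c = trans (cong₂ _+_ (∑-δ N c h (λ _ → vanish N<c)) (cong (_* h N) (δ-> N<c)))
                           (+-identityʳ (h c))

sum-applyUpTo : ∀ n (h g : ℕ → ℕ) → sum (map h (applyUpTo g n)) ≡ ∑[ i < n ] h (g i)
sum-applyUpTo zero    h g = refl
sum-applyUpTo (suc n) h g = trans (cong (h (g 0) +_) (sum-applyUpTo n h (g ∘ suc))) (∑-unshift n (h ∘ g))
  where
  ∑-unshift : ∀ n h → h 0 + ∑[ i < n ] h (suc i) ≡ ∑< (suc n) h
  ∑-unshift zero    h = +-comm (h 0) 0
  ∑-unshift (suc n) h = trans (sym (+-assoc (h 0) _ (h (suc n)))) (cong (_+ h (suc n)) (∑-unshift n h))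

conv-∑ : ∀ f g {n N} → n < N → conv f g n ≡ ∑[ i < N ] ∑[ j < N ] (δ (i + j) n * f i * g j)
conv-∑ f g {n} {N} n<N = begin
  conv f g n
    ≡⟨ sum-applyUpTo (suc n) _ id ⟩
  ∑[ i < suc n ] (f i * g (n ∸ i))
    ≡⟨ ∑-cong-< (suc n) (λ i i≤n → sym (inner i (≤-pred i≤n))) ⟩
  ∑[ i < suc n ] ∑[ j < N ] (δ (i + j) n * f i * g j)
    ≡⟨ ∑-extend _ n<N outer-vanish ⟨
  ∑[ i < N ] ∑[ j < N ] (δ (i + j) n * f i * g j) ∎
  where
  open ≡-Reasoning
  outer-vanish : ∀ i → suc n ≤ i → ∑[ j < N ] (δ (i + j) n * f i * g j) ≡ 0
  outer-vanish i n<i = ∑-zero N (λ j _ → cong (λ d → d * f i * g j) (δ-+-vanishˡ j n<i))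
  inner : ∀ i → i ≤ n → ∑[ j < N ] (δ (i + j) n * f i * g j) ≡ f i * g (n ∸ i)
  inner i i≤n = trans (∑-cong N (λ j → trans (*-assoc (δ (i + j) n) (f i) (g j)) (cong (_* (f i * g j)) (δ-solve j))))
                      (∑-δ N (n ∸ i) (λ j → f i * g j) (⊥-elim ∘ <⇒≱ (≤-<-trans (m∸n≤m n i) n<N)))
    where
    δ-solve : ∀ j → δ (i + j) n ≡ δ (n ∸ i) j
    δ-solve j = δ-cong-⇔ (λ i+j≡n → trans (cong (_∸ i) (sym i+j≡n)) (m+n∸m≡n i j))
                         (λ n∸i≡j → trans (cong (i +_) (sym n∸i≡j)) (m+[n∸m]≡n i≤n))

-- The summand of `dil` is a where-bound function of Defs that cannot be named here;
-- `summand` recovers it from the definitional unfolding of `dil c f n`.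
summand : ∀ n {t : ℕ → ℕ} {x : ℕ} → x ≡ sum (map t (upTo n)) → ℕ → ℕ
summand _ {t} _ = t

dil-∑ : ∀ {c} f {n N} → 0 < c → n < N → dil c f n ≡ ∑[ m < N ] (δ (c * m) n * f m)
dil-∑ {c} f {n} {N} 0<c n<N = begin
  dil c f n
    ≡⟨ sum-applyUpTo (suc n) _ id ⟩
  ∑< (suc n) (summand (suc n) refl)
    ≡⟨ ∑-cong (suc n) summand≡ ⟩
  ∑[ m < suc n ] (δ (c * m) n * f m)
    ≡⟨ ∑-extend _ n<N (λ m n<m → cong (_* f m) (δ-> (<-≤-trans n<m (m≤n*m m c {{>-nonZero 0<c}})))) ⟨
  ∑[ m < N ] (δ (c * m) n * f m) ∎
  where
  open ≡-Reasoning
  summand≡ : ∀ m → summand (suc n) (refl {x = dil c f n}) m ≡ δ (c * m) n * f m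
  summand≡ m with c * m ≟ n
  ... | yes _ = sym (+-identityʳ (f m))
  ... | no  _ = refl

∑-conv : ∀ f g {N} (w : ℕ → ℕ) → (∀ k → N ≤ k → w k ≡ 0) →
         ∑[ k < N ] (w k * conv f g k) ≡ ∑[ i < N ] ∑[ j < N ] (w (i + j) * f i * g j)
∑-conv f g {N} w vanish = begin
  ∑[ k < N ] (w k * conv f g k)
    ≡⟨ ∑-cong-< N (λ k k<N → cong (w k *_) (conv-∑ f g k<N)) ⟩
  ∑[ k < N ] (w k * ∑[ i < N ] ∑[ j < N ] (δ (i + j) k * f i * g j))
    ≡⟨ ∑-cong N (λ k → ∑∑-distribˡ N N (w k) _) ⟩
  ∑[ k < N ] ∑[ i < N ] ∑[ j < N ] (w k * (δ (i + j) k * f i * g j))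
    ≡⟨ ∑-rotate₃ N _ ⟩
  ∑[ i < N ] ∑[ j < N ] ∑[ k < N ] (w k * (δ (i + j) k * f i * g j))
    ≡⟨ ∑-cong N (λ i → ∑-cong N (λ j → ∑-cong N (λ k → *-exchange (w k) (δ (i + j) k) (f i) (g j)))) ⟩
  ∑[ i < N ] ∑[ j < N ] ∑[ k < N ] (δ (i + j) k * (w k * f i * g j))
    ≡⟨ ∑-cong N (λ i → ∑-cong N (λ j → ∑-δ N (i + j) _ (cong (λ x → x * f i * g j) ∘ vanish (i + j)))) ⟩
  ∑[ i < N ] ∑[ j < N ] (w (i + j) * f i * g j) ∎
  where
  open ≡-Reasoning
  *-exchange : ∀ a b x y → a * (b * x * y) ≡ b * (a * x * y)
  *-exchange = solve-∀

∑-dil : ∀ {c} f {N} (w : ℕ → ℕ) → 0 < c → (∀ k → N ≤ k → w k ≡ 0) →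
        ∑[ k < N ] (w k * dil c f k) ≡ ∑[ i < N ] (w (c * i) * f i)
∑-dil {c} f {N} w 0<c vanish = begin
  ∑[ k < N ] (w k * dil c f k)
    ≡⟨ ∑-cong-< N (λ k k<N → cong (w k *_) (dil-∑ f 0<c k<N)) ⟩
  ∑[ k < N ] (w k * ∑[ i < N ] (δ (c * i) k * f i))
    ≡⟨ ∑-cong N (λ k → ∑-distribˡ N (w k) _) ⟩
  ∑[ k < N ] ∑[ i < N ] (w k * (δ (c * i) k * f i))
    ≡⟨ ∑-comm N N _ ⟩
  ∑[ i < N ] ∑[ k < N ] (w k * (δ (c * i) k * f i))
    ≡⟨ ∑-cong N (λ i → ∑-cong N (λ k → x∙yz≈y∙xz (w k) (δ (c * i) k) (f i))) ⟩
  ∑[ i < N ] ∑[ k < N ] (δ (c * i) k * (w k * f i))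
    ≡⟨ ∑-cong N (λ i → ∑-δ N (c * i) _ (λ N≤ci → cong (_* f i) (vanish (c * i) N≤ci))) ⟩
  ∑[ i < N ] (w (c * i) * f i) ∎
  where open ≡-Reasoning

δ₀ : ℕ → ℕ
δ₀ = δ 0

conv-cong : ∀ {f f′ g g′} → f ≗ f′ → g ≗ g′ → conv f g ≗ conv f′ g′
conv-cong f≗f′ g≗g′ n =
  cong sum (map-cong (λ i → cong₂ _*_ (f≗f′ i) (g≗g′ (n ∸ i))) (upTo (suc n)))

conv-comm : ∀ f g → conv f g ≗ conv g f
conv-comm f g n = begin
  conv f g n
    ≡⟨ conv-∑ f g ≤-refl ⟩
  ∑[ i < suc n ] ∑[ j < suc n ] (δ (i + j) n * f i * g j)
    ≡⟨ ∑-comm (suc n) (suc n) _ ⟩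
  ∑[ j < suc n ] ∑[ i < suc n ] (δ (i + j) n * f i * g j)
    ≡⟨ ∑-cong (suc n) (λ j → ∑-cong (suc n) (λ i → swap i j)) ⟩
  ∑[ j < suc n ] ∑[ i < suc n ] (δ (j + i) n * g j * f i)
    ≡⟨ conv-∑ g f ≤-refl ⟨
  conv g f n ∎
  where
  open ≡-Reasoning
  swap : ∀ i j → δ (i + j) n * f i * g j ≡ δ (j + i) n * g j * f i
  swap i j = trans (xy∙z≈xz∙y (δ (i + j) n) (f i) (g j))
                   (cong (λ s → δ s n * g j * f i) (+-comm i j))

conv-identityʳ : ∀ f → conv f δ₀ ≗ f
conv-identityʳ f n = begin
  conv f δ₀ n
    ≡⟨ conv-∑ f δ₀ ≤-refl ⟩
  ∑[ i < suc n ] ∑[ j < suc n ] (δ (i + j) n * f i * δ 0 j)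
    ≡⟨ ∑-cong (suc n) (λ i → ∑-cong (suc n) (λ j → *-comm _ (δ 0 j))) ⟩
  ∑[ i < suc n ] ∑[ j < suc n ] (δ 0 j * (δ (i + j) n * f i))
    ≡⟨ ∑-cong (suc n) (λ i → ∑-δ (suc n) 0 _ (λ ())) ⟩
  ∑[ i < suc n ] (δ (i + 0) n * f i)
    ≡⟨ ∑-cong (suc n) (λ i → cong (_* f i) (trans (cong (λ s → δ s n) (+-identityʳ i)) (δ-sym i n))) ⟩
  ∑[ i < suc n ] (δ n i * f i)
    ≡⟨ ∑-δ (suc n) n f (⊥-elim ∘ <⇒≱ ≤-refl) ⟩
  f n ∎
  where open ≡-Reasoning

conv-conv-∑ : ∀ f g h n → conv (conv f g) h n ≡
  ∑[ i < suc n ] ∑[ j < suc n ] ∑[ l < suc n ] (δ (i + j + l) n * f i * g j * h l)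
conv-conv-∑ f g h n = begin
  conv (conv f g) h n
    ≡⟨ conv-∑ (conv f g) h ≤-refl ⟩
  ∑[ k < N ] ∑[ l < N ] (δ (k + l) n * conv f g k * h l)
    ≡⟨ ∑-comm N N _ ⟩
  ∑[ l < N ] ∑[ k < N ] (δ (k + l) n * conv f g k * h l)
    ≡⟨ ∑-cong N (λ l → ∑-distribʳ N (h l) _) ⟨
  ∑[ l < N ] (∑[ k < N ] (δ (k + l) n * conv f g k) * h l)
    ≡⟨ ∑-cong N (λ l → cong (_* h l) (∑-conv f g (λ k → δ (k + l) n) (λ k → δ-+-vanishˡ l))) ⟩
  ∑[ l < N ] ((∑[ i < N ] ∑[ j < N ] (δ (i + j + l) n * f i * g j)) * h l)
    ≡⟨ ∑-cong N (λ l → ∑∑-distribʳ N N (h l) _) ⟩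
  ∑[ l < N ] ∑[ i < N ] ∑[ j < N ] (δ (i + j + l) n * f i * g j * h l)
    ≡⟨ ∑-rotate₃ N _ ⟩
  ∑[ i < N ] ∑[ j < N ] ∑[ l < N ] (δ (i + j + l) n * f i * g j * h l) ∎
  where
  open ≡-Reasoning
  N : ℕ
  N = suc n

conv-assoc : ∀ f g h → conv (conv f g) h ≗ conv f (conv g h)
conv-assoc f g h n = begin
  conv (conv f g) h n
    ≡⟨ conv-conv-∑ f g h n ⟩
  ∑[ i < suc n ] ∑[ j < suc n ] ∑[ l < suc n ] (δ (i + j + l) n * f i * g j * h l)
    ≡⟨ ∑-cong (suc n) (λ i → ∑-cong (suc n) (λ j → ∑-cong (suc n) (λ l → rearrange i j l))) ⟩
  ∑[ i < suc n ] ∑[ j < suc n ] ∑[ l < suc n ] (δ (j + l + i) n * g j * h l * f i)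
    ≡⟨ ∑-rotate₃ (suc n) _ ⟩
  ∑[ j < suc n ] ∑[ l < suc n ] ∑[ i < suc n ] (δ (j + l + i) n * g j * h l * f i)
    ≡⟨ conv-conv-∑ g h f n ⟨
  conv (conv g h) f n
    ≡⟨ conv-comm (conv g h) f n ⟩
  conv f (conv g h) n ∎
  where
  open ≡-Reasoning
  rearrange : ∀ i j l → δ (i + j + l) n * f i * g j * h l ≡ δ (j + l + i) n * g j * h l * f i
  rearrange i j l = trans (cong (λ s → δ s n * f i * g j * h l) (trans (+-assoc i j l) (+-comm i (j + l))))
                          (*-rotate (δ (j + l + i) n) (f i) (g j) (h l))
    where
    *-rotate : ∀ d x y z → d * x * y * z ≡ d * y * z * x
    *-rotate = solve-∀

conv-isCommutativeMonoid : IsCommutativeMonoid _≗_ conv δ₀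
conv-isCommutativeMonoid = record
  { isMonoid = record
    { isSemigroup = record
      { isMagma = record { isEquivalence = Setoid.isEquivalence (ℕ →-setoid ℕ) ; ∙-cong = conv-cong }
      ; assoc   = conv-assoc
      }
    ; identity = (λ f n → trans (conv-comm δ₀ f n) (conv-identityʳ f n)) , conv-identityʳ
    }
  ; comm = conv-comm
  }

Conv : CommutativeMonoid 0ℓ 0ℓ
Conv = record { isCommutativeMonoid = conv-isCommutativeMonoid }

-- For c = 0, `dil c` does not model the dilation 0A (which is infinite at 0).
module _ {c : ℕ} (0<c : 0 < c) where

  δ-*-vanish : ∀ {n k} → suc n ≤ k → δ (c * k) n ≡ 0
  δ-*-vanish {n} {k} n<k = δ-> (<-≤-trans n<k (m≤n*m k c {{>-nonZero 0<c}}))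

  dil-cong : ∀ {f g} → f ≗ g → dil c f ≗ dil c g
  dil-cong {f} {g} f≗g n = trans (dil-∑ f 0<c ≤-refl)
    (trans (∑-cong (suc n) (λ m → cong (δ (c * m) n *_) (f≗g m))) (sym (dil-∑ g 0<c ≤-refl)))

  dil-δ₀ : dil c δ₀ ≗ δ₀
  dil-δ₀ n = begin
    dil c δ₀ n                             ≡⟨ dil-∑ δ₀ 0<c ≤-refl ⟩
    ∑[ m < suc n ] (δ (c * m) n * δ 0 m)   ≡⟨ ∑-cong (suc n) (λ m → *-comm (δ (c * m) n) (δ 0 m)) ⟩
    ∑[ m < suc n ] (δ 0 m * δ (c * m) n)   ≡⟨ ∑-δ (suc n) 0 _ (λ ()) ⟩
    δ (c * 0) n                            ≡⟨ cong (λ x → δ x n) (*-zeroʳ c) ⟩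
    δ 0 n                                  ∎
    where open ≡-Reasoning

  dil-conv : ∀ f g → dil c (conv f g) ≗ conv (dil c f) (dil c g)
  dil-conv f g n = begin
    dil c (conv f g) n
      ≡⟨ dil-∑ (conv f g) 0<c ≤-refl ⟩
    ∑[ k < N ] (δ (c * k) n * conv f g k)
      ≡⟨ ∑-conv f g _ (λ k → δ-*-vanish) ⟩
    ∑[ i < N ] ∑[ j < N ] (δ (c * (i + j)) n * f i * g j)
      ≡⟨ ∑-cong N (λ i → ∑-cong N (λ j → cong (λ x → δ x n * f i * g j) (*-distribˡ-+ c i j))) ⟩
    ∑[ i < N ] ∑[ j < N ] (δ (c * i + c * j) n * f i * g j)
      ≡⟨ ∑-comm N N _ ⟩
    ∑[ j < N ] ∑[ i < N ] (δ (c * i + c * j) n * f i * g j)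
      ≡⟨ ∑-cong N (λ j → ∑-distribʳ N (g j) _) ⟨
    ∑[ j < N ] (∑[ i < N ] (δ (c * i + c * j) n * f i) * g j)
      ≡⟨ ∑-cong N (λ j → cong (_* g j) (∑-dil f (λ a → δ (a + c * j) n) 0<c (λ a → δ-+-vanishˡ (c * j)))) ⟨
    ∑[ j < N ] (∑[ a < N ] (δ (a + c * j) n * dil c f a) * g j)
      ≡⟨ ∑-cong N (λ j → ∑-distribʳ N (g j) _) ⟩
    ∑[ j < N ] ∑[ a < N ] (δ (a + c * j) n * dil c f a * g j)
      ≡⟨ ∑-comm N N _ ⟨
    ∑[ a < N ] ∑[ j < N ] (δ (a + c * j) n * dil c f a * g j)
      ≡⟨ ∑-cong N (λ a → ∑-dil g _ 0<c (λ b → cong (_* dil c f a) ∘ δ-+-vanishʳ a)) ⟨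
    ∑[ a < N ] ∑[ b < N ] (δ (a + b) n * dil c f a * dil c g b)
      ≡⟨ conv-∑ (dil c f) (dil c g) ≤-refl ⟨
    conv (dil c f) (dil c g) n ∎
    where
    open ≡-Reasoning
    N : ℕ
    N = suc n

dil-dil : ∀ {a b} f → 0 < a → 0 < b → dil a (dil b f) ≗ dil (a * b) f
dil-dil {a} {b} f 0<a 0<b n = begin
  dil a (dil b f) n
    ≡⟨ dil-∑ (dil b f) 0<a ≤-refl ⟩
  ∑[ k < suc n ] (δ (a * k) n * dil b f k)
    ≡⟨ ∑-dil f _ 0<b (λ k → δ-*-vanish 0<a) ⟩
  ∑[ i < suc n ] (δ (a * (b * i)) n * f i)
    ≡⟨ ∑-cong (suc n) (λ i → cong (λ x → δ x n * f i) (*-assoc a b i)) ⟨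
  ∑[ i < suc n ] (δ (a * b * i) n * f i)
    ≡⟨ dil-∑ f (*-mono-< 0<a 0<b) ≤-refl ⟨
  dil (a * b) f n ∎
  where open ≡-Reasoning

kron-≢[] : ∀ {P Q} → P ≢ [] → Q ≢ [] → kron P Q ≢ []
kron-≢[] {[]}    {_}     P≢[] _    _       = P≢[] refl
kron-≢[] {_ ∷ _} {[]}    _    Q≢[] _       = Q≢[] refl
kron-≢[] {P@(_ ∷ _)} {Q@(_ ∷ _)} _ _ kron≡[] =
  ¬x∷xs↭[] (subst (products ↭_) kron≡[] (↭-sym (sort-↭ products)))
  where
  products : List ℕ
  products = concatMap (λ p → map (p *_) Q) P

kron-positive : ∀ {P Q} → All (0 <_) P → All (0 <_) Q → All (0 <_) (kron P Q)
kron-positive P>0 Q>0 = All-resp-↭ (↭-sym (sort-↭ _))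
  (concat⁺ (All.map⁺ (All.map (λ 0<p → All.map⁺ (All.map (*-mono-< 0<p) Q>0)) P>0)))

NonEmptyPositive : List ℕ → Set
NonEmptyPositive l = l ≢ [] × All (0 <_) l

nonEmptyPositive : ∀ {l} → IsZm l → NonEmptyPositive l
nonEmptyPositive (l≢[] , l>0 , _) = l≢[] , l>0

kron-nonEmptyPositive : ∀ {P Q} → NonEmptyPositive P → NonEmptyPositive Q → NonEmptyPositive (kron P Q)
kron-nonEmptyPositive (P≢[] , P>0) (Q≢[] , Q>0) = kron-≢[] P≢[] Q≢[] , kron-positive P>0 Q>0

open BigProduct Conv
open CommutativeMonoid Conv using () renaming (setoid to conv-setoid)

R-∏ : ∀ f α → α ≢ [] → R f α ≗ ∏ α (λ a → dil a f)
R-∏ f []          α≢[] = ⊥-elim (α≢[] refl)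
R-∏ f (a ∷ [])    _    = λ n → sym (conv-identityʳ (dil a f) n)
R-∏ f (a ∷ b ∷ α) _    = conv-cong {dil a f} (λ _ → refl) (R-∏ f (b ∷ α) (λ ()))

R-cong : ∀ {f g} α → All (0 <_) α → f ≗ g → R f α ≗ R g α
R-cong []          _              f≗g = λ _ → refl
R-cong (a ∷ [])    (0<a ∷ _)      f≗g = dil-cong 0<a f≗g
R-cong (a ∷ b ∷ α) (0<a ∷ b∷α>0)  f≗g = conv-cong (dil-cong 0<a f≗g) (R-cong (b ∷ α) b∷α>0 f≗g)

dil-∏ : ∀ {c} → 0 < c → ∀ (L : List ℕ) F → dil c (∏ L F) ≗ ∏ L (dil c ∘ F)
dil-∏ {c} 0<c = ∏-hom (dil c) (dil-δ₀ 0<c) (dil-conv 0<c)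

R-R-kron : ∀ f {α β} → NonEmptyPositive α → NonEmptyPositive β → R (R f α) β ≗ R f (kron β α)
R-R-kron f {α} {β} (α≢[] , α>0) (β≢[] , β>0) = begin
  R (R f α) β
    ≈⟨ R-∏ (R f α) β β≢[] ⟩
  ∏ β (λ b → dil b (R f α))
    ≈⟨ ∏-cong-All β>0 (λ 0<b → dil-cong 0<b (R-∏ f α α≢[])) ⟩
  ∏ β (λ b → dil b (∏ α (λ a → dil a f)))
    ≈⟨ ∏-cong-All β>0 (λ 0<b → dil-∏ 0<b α _) ⟩
  ∏ β (λ b → ∏ α (λ a → dil b (dil a f)))
    ≈⟨ ∏-cong-All β>0 (λ 0<b → ∏-cong-All α>0 (λ 0<a → dil-dil f 0<b 0<a)) ⟩
  ∏ β (λ b → ∏ α (λ a → dil (b * a) f))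
    ≈⟨ ∏-kron β α _ ⟨
  ∏ (kron β α) (λ c → dil c f)
    ≈⟨ R-∏ f (kron β α) (kron-≢[] β≢[] α≢[]) ⟨
  R f (kron β α) ∎
  where open ≈-Reasoning conv-setoid

R-kron-kron-reverse : ∀ f {P Q S} → P ≢ [] → Q ≢ [] → S ≢ [] →
                      R f (kron (kron P Q) S) ≗ R f (kron (kron S Q) P)
R-kron-kron-reverse f {P} {Q} {S} P≢[] Q≢[] S≢[] = begin
  R f (kron (kron P Q) S)
    ≈⟨ R-∏ f _ (kron-≢[] (kron-≢[] P≢[] Q≢[]) S≢[]) ⟩
  ∏ (kron (kron P Q) S) (λ c → dil c f)
    ≈⟨ ∏-kron-kron P Q S _ ⟩
  ∏ P (λ p → ∏ Q (λ q → ∏ S (λ s → dil (p * q * s) f)))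
    ≈⟨ ∏-reverse₃ P Q S _ ⟩
  ∏ S (λ s → ∏ Q (λ q → ∏ P (λ p → dil (p * q * s) f)))
    ≈⟨ ∏-cong S (λ s → ∏-cong Q (λ q → ∏-cong P (λ p → cong-dil (xy∙z≈zy∙x p q s)))) ⟩
  ∏ S (λ s → ∏ Q (λ q → ∏ P (λ p → dil (s * q * p) f)))
    ≈⟨ ∏-kron-kron S Q P _ ⟨
  ∏ (kron (kron S Q) P) (λ c → dil c f)
    ≈⟨ R-∏ f _ (kron-≢[] (kron-≢[] S≢[] Q≢[]) P≢[]) ⟨
  R f (kron (kron S Q) P) ∎
  where
  open ≈-Reasoning conv-setoid
  cong-dil : ∀ {k l} → k ≡ l → dil k f ≗ dil l f
  cong-dil k≡l n = cong (λ k → dil k f n) k≡l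

R-R-exchange : ∀ f {α α₁ α₂} → NonEmptyPositive α → NonEmptyPositive α₁ → NonEmptyPositive α₂ →
               R (R f α₁) (kron α α₂) ≗ R (R f α) (kron α₁ α₂)
R-R-exchange f {α} {α₁} {α₂} α⁺ α₁⁺ α₂⁺ = begin
  R (R f α₁) (kron α α₂)       ≈⟨ R-R-kron f α₁⁺ (kron-nonEmptyPositive α⁺ α₂⁺) ⟩
  R f (kron (kron α α₂) α₁)    ≈⟨ R-kron-kron-reverse f (proj₁ α⁺) (proj₁ α₂⁺) (proj₁ α₁⁺) ⟩
  R f (kron (kron α₁ α₂) α)    ≈⟨ R-R-kron f α⁺ (kron-nonEmptyPositive α₁⁺ α₂⁺) ⟨
  R (R f α) (kron α₁ α₂)       ∎
  where open ≈-Reasoning conv-setoid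

proposition1p9 : (α β α₁ α₂ β₁ β₂ : List ℕ) (A B : NMultiset) →
    IsZm α → IsZm β → IsZm α₁ → IsZm α₂ → IsZm β₁ → IsZm β₂ →
    (∀ n → R (χ A) α n ≡ R (χ B) β n) →
    kron α₁ α₂ ≡ kron β₁ β₂ →
    ∀ n → R (R (χ A) α₁) (kron α α₂) n ≡ R (R (χ B) β₁) (kron β β₂) n
proposition1p9 α β α₁ α₂ β₁ β₂ A B α∈ β∈ α₁∈ α₂∈ β₁∈ β₂∈ αA≗βB α₁α₂≡β₁β₂ = begin
  R (R (χ A) α₁) (kron α α₂)
    ≈⟨ R-R-exchange (χ A) (nonEmptyPositive α∈) (nonEmptyPositive α₁∈) (nonEmptyPositive α₂∈) ⟩
  R (R (χ A) α) (kron α₁ α₂)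
    ≈⟨ R-cong (kron α₁ α₂) α₁α₂>0 αA≗βB ⟩
  R (R (χ B) β) (kron α₁ α₂)
    ≡⟨ cong (R (R (χ B) β)) α₁α₂≡β₁β₂ ⟩
  R (R (χ B) β) (kron β₁ β₂)
    ≈⟨ R-R-exchange (χ B) (nonEmptyPositive β∈) (nonEmptyPositive β₁∈) (nonEmptyPositive β₂∈) ⟨
  R (R (χ B) β₁) (kron β β₂) ∎
  where
  open ≈-Reasoning conv-setoid
  α₁α₂>0 : All (0 <_) (kron α₁ α₂)
  α₁α₂>0 = proj₂ (kron-nonEmptyPositive (nonEmptyPositive α₁∈) (nonEmptyPositive α₂∈))
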